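{- Let $N=(S,A,T,I)$ be a finite PTI net and $m_1,m_2$ two markings of $N$. If $m_1\sim_p m_2$ (pti-place bisimilarity), then $m_1\sim_{cn} m_2$ (causal-net bisimilarity).
   Context: Multisets over a finite set $S$ are functions $m:S\to\mathbb{N}$; $\mathcal{M}(S)$ is their set, $\theta$ the empty multiset, $\subseteq$ pointwise order, $\oplus$ pointwise sum, $(m\ominus m')(s)=\max\{m(s)-m'(s),0\}$, $\mathit{dom}(m)=\{s\mid m(s)\ne0\}$; a place $s$ also denotes the singleton multiset. A finite PTI net is $N=(S,A,T,I)$ with finite places $S$, finite labels $A$, finite transitions $T\subseteq(\mathcal{M}(S)\setminus\{\theta\})\times A\times(\mathcal{M}(S)\setminus\{\theta\})$ and inhibiting relation $I\subseteq S\times T$. For $t=(m,\ell,m')$: ${}^\bullet t=m$, $l(t)=\ell$, $t^\bullet=m'$, ${}^\circ t=\{s\mid(s,t)\in I\}$. $t$ is enabled at $m$ if ${}^\bullet t\subseteq m$ and ${}^\circ t\cap\mathit{dom}(m)=\emptyset$, and then $m[t\rangle m'$ with $m'=(m\ominus{}^\bullet t)\oplus t^\bullet$. Pti-place bisimilarity: for $R\subseteq S\times S$, $R^\oplus$ is the least relation on $\mathcal{M}(S)$ with $(\theta,\theta)\in R^\oplus$ and $(s_1\oplus m_1,s_2\oplus m_2)\in R^\oplus$ whenever $(s_1,s_2)\in R$ and $(m_1,m_2)\in R^\oplus$. $R$ is a pti-place bisimulation if whenever $(m_1,m_2)\in R^\oplus$: (1) for every $t_1$ with $m_1[t_1\rangle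 m_1'$ there is $t_2$ with $m_2[t_2\rangle m_2'$ such that (a) $({}^\bullet t_1,{}^\bullet t_2)\in R^\oplus$, $(t_1^\bullet,t_2^\bullet)\in R^\oplus$, $l(t_1)=l(t_2)$, $(m_1\ominus{}^\bullet t_1,m_2\ominus{}^\bullet t_2)\in R^\oplus$, and (b) for all $(s,s')\in R$, $s\in{}^\circ t_1\iff s'\in{}^\circ t_2$; (2) symmetrically when $m_2$ moves first. $m_1\sim_p m_2$ iff some pti-place bisimulation $R$ has $(m_1,m_2)\in R^\oplus$. Causal nets: a causal P/T net is a finite marked net $C=(B,L,E,\mathsf{m}_0)$ (conditions $B$, events $E$, labels $L$, each event $e$ having a pre-set ${}^\bullet e$, label $\mathsf{l}(e)$ and post-set $e^\bullet$) with flow relation $\mathsf{F}=\{(b,e)\mid b\in{}^\bullet e\}\cup\{(e,b)\mid b\in e^\bullet\}$, such that $\mathsf{F}$ is acyclic; for each $b$, ${}^\bullet b=\{e\mid b\in e^\bullet\}$ and $b^\bullet=\{e\mid b\in{}^\bullet e\}$ have at most one element; $\mathsf{m}_0(b)=1$ if ${}^\bullet b=\emptyset$ and $0$ otherwise; all arcs have weight at most 1. $Min(C)=\mathsf{m}_0$, $Max(C)=\{b\mid b^\bullet=\emptyset\}$. A causal PTI net is $C=(B,L,E,Y^{be},Y^{af},\mathsf{m}_0)$ where $(B,L,E,\mathsf{m}_0)$ is a causal P/T net, $Y^{be},Y^{af}\subseteq B\times E$ ("before" and "after" inhibitor arcs), if $(b,e)\in Y^{be}$ then $(e',b)\in\mathsf{F}$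 for some event $e'$, if $(b,e)\in Y^{af}$ then $(b,e')\in\mathsf{F}$ for some event $e'$, and $\mathsf{F}\cup\prec_{af}\cup\prec_{be}$ is acyclic, where $e\prec_{af}e'$ iff there is $b$ with $(b,e)\in\mathsf{F}$ and $(b,e')\in Y^{af}$, and $e\prec_{be}e'$ iff there is $b$ with $(e',b)\in\mathsf{F}$ and $(b,e)\in Y^{be}$. A folding of $C$ into the marked net $N(m_0)$ is a map $\rho:B\cup E\to S\cup T$ with $\rho(B)\subseteq S$, $\rho(E)\subseteq T$, $L=A$, $\mathsf{l}(e)=l(\rho(e))$, $m_0(s)=|\rho^{ -1}(s)\cap\mathsf{m}_0|$, ${}^\bullet\rho(e)(s)=|\rho^{ -1}(s)\cap{}^\bullet e|$ and $\rho(e)^\bullet(s)=|\rho^{ -1}(s)\cap e^\bullet|$ for all $s,e$; moreover, if $(s,\rho(e))\in I$ then every $b$ with $\rho(b)=s$ satisfies $(b,e)\in Y^{be}\cup Y^{af}\cup\mathsf{F}^{ -1}$, and if $(b,e)\in Y^{be}\cup Y^{af}$ then $(\rho(b),\rho(e))\in I$. A PTI process of $N(m_0)$ is a pair $(C,\rho)$ with $\rho$ such a folding. For PTI processes $(C_i,\rho_i)$, $C_i=(B_i,L,E_i,Y_i^{be},Y_i^{af},\mathsf{m}_0)$, of $N(m_0)$, $(C_1,\rho_1)\xrightarrow{e}(C_2,\rho_2)$ holds if ${}^\bullet e\subseteq Max(C_1)$, $E_2=E_1\cup\{e\}$, $B_2=B_1\cup e^\bullet$, $\rho_1\subseteq\rho_2$;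 and, defining $\mathcal{B}$ by $b\,\mathcal{B}\,e'$ iff $(\rho_2(b),\rho_2(e'))\in I$ for $b\in e^\bullet$, $e'\in E_1$, and $\mathcal{A}$ by $b\,\mathcal{A}\,e$ iff $(\rho_2(b),\rho_2(e))\in I$ for $b\in B_2$ with $b^\bullet\ne\emptyset$ (in $C_2$), one has $\{b\in B_2\mid b\,\mathcal{A}\,e\}\cap Max(C_1)=\emptyset$, $Y_2^{be}=Y_1^{be}\cup\mathcal{B}$ and $Y_2^{af}=Y_1^{af}\cup\mathcal{A}$. A causal-net bisimulation is a set $R$ of triples $(\rho_1,C,\rho_2)$ where, for $i=1,2$, $(C,\rho_i)$ is a PTI process of $N(m_{0i})$ for some marking $m_{0i}$, such that whenever $(\rho_1,C,\rho_2)\in R$: (i) for all $t_1,C',\rho_1'$ with $(C,\rho_1)\xrightarrow{e}(C',\rho_1')$ and $\rho_1'(e)=t_1$, there exist $t_2,\rho_2'$ with $(C,\rho_2)\xrightarrow{e}(C',\rho_2')$, $\rho_2'(e)=t_2$ and $(\rho_1',C',\rho_2')\in R$; (ii) symmetrically when $(C,\rho_2)$ moves. Markings $m_1,m_2$ are causal-net bisimilar, $m_1\sim_{cn}m_2$, if some causal-net bisimulation contains a triple $(\rho_1^0,C^0,\rho_2^0)$ where $C^0$ has no events and $\rho_i^0(Min(C^0))=\rho_i^0(Max(C^0))=m_i$ (as multisets) for $i=1,2$. -}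

module Defs where

open import Data.Nat using (ℕ; zero; suc; _+_; _∸_; _≤_)
open import Data.Bool using (Bool; true; false; _∧_; _∨_; not; if_then_else_)
open import Data.Fin using (Fin; zero; suc; _≟_; _↑ˡ_; _↑ʳ_)
open import Data.Vec using (Vec; lookup; tabulate; zipWith; replicate)
open import Data.Product using (Σ; ∃; ∃-syntax; _×_; _,_)
open import Data.Sum using (_⊎_; inj₁; inj₂)
open import Relation.Nullary using (¬_)
open import Relation.Nullary.Decidable using (⌊_⌋)
open import Relation.Binary.PropositionalEquality using (_≡_; _≢_)
open import Relation.Binary.Construct.Closure.Transitive using (TransClosure)
open import Function.Bundles using (_⇔_)

-- Finite sets are Fin n; finite subsets / relations are Bool-valued.

count : ∀ {n} → (Fin n → Bool) → ℕ
count {zero}  f = 0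
count {suc n} f = (if f zero then 1 else 0) + count (λ i → f (suc i))

anyB : ∀ {n} → (Fin n → Bool) → Bool
anyB {zero}  f = false
anyB {suc n} f = f zero ∨ anyB (λ i → f (suc i))

-- Multisets over the finite set S = Fin n  (m(s) = lookup m s)

MS : ℕ → Set
MS n = Vec ℕ n

θ : ∀ {n} → MS n
θ {n} = replicate n 0

⟦_⟧ : ∀ {n} → Fin n → MS n
⟦ s ⟧ = tabulate (λ s' → if ⌊ s ≟ s' ⌋ then 1 else 0)

_⊕_ : ∀ {n} → MS n → MS n → MS n
_⊕_ = zipWith _+_

-- (m ⊖ m')(s) = max(m(s) - m'(s), 0) = m(s) ∸ m'(s)
_⊖_ : ∀ {n} → MS n → MS n → MS n
_⊖_ = zipWith _∸_

_⊆_ : ∀ {n} → MS n → MS n → Set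
m ⊆ m' = ∀ s → lookup m s ≤ lookup m' s

-- Finite PTI nets  N = (S, A, T, I)
-- S = Fin nS, A = Fin nA, T = Fin nT where each transition t denotes the
-- triple (pre t, lab t, post t); distinct indices denote distinct triples.

record PTINet : Set where
  field
    nS nA nT : ℕ
    pre  : Fin nT → MS nS
    lab  : Fin nT → Fin nA
    post : Fin nT → MS nS
    pre≢θ  : ∀ t → pre t ≢ θ
    post≢θ : ∀ t → post t ≢ θ
    triple-inj : ∀ t t' → pre t ≡ pre t' → lab t ≡ lab t' → post t ≡ post t' → t ≡ t'
    I : Fin nS → Fin nT → Bool

module _ (N : PTINet) where
  open PTINet N

  Marking : Set
  Marking = MS nS

  Enabled : Fin nT → Marking → Set
  Enabled t m = (pre t ⊆ m) × (∀ s → I s t ≡ true → lookup m s ≡ 0)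

  Fires : Marking → Fin nT → Marking → Set
  Fires m t m' = Enabled t m × (m' ≡ (m ⊖ pre t) ⊕ post t)

  data Lift (R : Fin nS → Fin nS → Set) : Marking → Marking → Set where
    nil  : Lift R θ θ
    cons : ∀ {s₁ s₂ m₁ m₂} → R s₁ s₂ → Lift R m₁ m₂ → Lift R (⟦ s₁ ⟧ ⊕ m₁) (⟦ s₂ ⟧ ⊕ m₂)

  Match : (R : Fin nS → Fin nS → Set) → Marking → Fin nT → Marking → Fin nT → Set
  Match R m₁ t₁ m₂ t₂ =
      Lift R (pre t₁) (pre t₂)
    × Lift R (post t₁) (post t₂)
    × lab t₁ ≡ lab t₂
    × Lift R (m₁ ⊖ pre t₁) (m₂ ⊖ pre t₂)
    × (∀ s s' → R s s' → (I s t₁ ≡ true ⇔ I s' t₂ ≡ true))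

  IsPtiPlaceBisim : (Fin nS → Fin nS → Set) → Set
  IsPtiPlaceBisim R = ∀ m₁ m₂ → Lift R m₁ m₂ →
      (∀ t₁ m₁' → Fires m₁ t₁ m₁' → ∃[ t₂ ] ∃[ m₂' ] (Fires m₂ t₂ m₂' × Match R m₁ t₁ m₂ t₂))
    × (∀ t₂ m₂' → Fires m₂ t₂ m₂' → ∃[ t₁ ] ∃[ m₁' ] (Fires m₁ t₁ m₁' × Match R m₁ t₁ m₂ t₂))

  _∼p_ : Marking → Marking → Set₁
  m₁ ∼p m₂ = ∃[ R ] (IsPtiPlaceBisim R × Lift R m₁ m₂)

-- (Raw) causal PTI nets with conditions B = Fin nB and events E = Fin nE,
-- labels in Fin nA.  Pre-/post-sets of events are subsets of B, so all arcs
-- have weight at most 1.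

record CNet (nA nB nE : ℕ) : Set where
  field
    pre  : Fin nE → Fin nB → Bool
    post : Fin nE → Fin nB → Bool
    lab  : Fin nE → Fin nA
    Ybe  : Fin nB → Fin nE → Bool
    Yaf  : Fin nB → Fin nE → Bool

module _ {nA nB nE : ℕ} (C : CNet nA nB nE) where
  open CNet C

  hasPre : Fin nB → Bool
  hasPre b = anyB (λ e → post e b)

  hasPost : Fin nB → Bool
  hasPost b = anyB (λ e → pre e b)

  isMin : Fin nB → Bool
  isMin b = not (hasPre b)

  isMax : Fin nB → Bool
  isMax b = not (hasPost b)

  data Order : Fin nB ⊎ Fin nE → Fin nB ⊎ Fin nE → Set where
    flow-in  : ∀ {b e} → pre e b ≡ true → Order (inj₁ b) (inj₂ e)
    flow-out : ∀ {e b} → post e b ≡ true → Order (inj₂ e) (inj₁ b)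
    af       : ∀ {e e'} b → pre e b ≡ true → Yaf b e' ≡ true → Order (inj₂ e) (inj₂ e')
    be       : ∀ {e e'} b → post e' b ≡ true → Ybe b e ≡ true → Order (inj₂ e) (inj₂ e')

  record IsCausal : Set where
    field
      pre-cond-unique  : ∀ b e e' → post e b ≡ true → post e' b ≡ true → e ≡ e'
      post-cond-unique : ∀ b e e' → pre e b ≡ true → pre e' b ≡ true → e ≡ e'
      Ybe-ok : ∀ b e → Ybe b e ≡ true → ∃[ e' ] post e' b ≡ true
      Yaf-ok : ∀ b e → Yaf b e ≡ true → ∃[ e' ] pre e' b ≡ true
      acyclic : ∀ x → ¬ TransClosure Order x x

record Folding (N : PTINet) (nB nE : ℕ) : Set where
  open PTINet N
  field
    ρB : Fin nB → Fin nS
    ρE : Fin nE → Fin nT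

module _ (N : PTINet) where
  open PTINet N

  preimCount : ∀ {nB nE} → Folding N nB nE → (Fin nB → Bool) → Fin nS → ℕ
  preimCount ρ X s = count (λ b → ⌊ Folding.ρB ρ b ≟ s ⌋ ∧ X b)

  image : ∀ {nB nE} → Folding N nB nE → (Fin nB → Bool) → MS nS
  image ρ X = tabulate (preimCount ρ X)

  record IsProcess (m₀ : MS nS) {nB nE} (C : CNet nA nB nE) (ρ : Folding N nB nE) : Set where
    private
      module C = CNet C
    open Folding ρ
    field
      causal    : IsCausal C
      lab-ok    : ∀ e → C.lab e ≡ PTINet.lab N (ρE e)
      init-ok   : ∀ s → lookup m₀ s ≡ preimCount ρ (isMin C) s
      pre-ok    : ∀ e s → lookup (PTINet.pre N (ρE e)) s ≡ preimCount ρ (C.pre e) s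
      post-ok   : ∀ e s → lookup (PTINet.post N (ρE e)) s ≡ preimCount ρ (C.post e) s
      inh-ok    : ∀ s e → I s (ρE e) ≡ true → ∀ b → ρB b ≡ s →
                    (C.Ybe b e ∨ C.Yaf b e ∨ C.post e b) ≡ true
      Y-ok      : ∀ b e → (C.Ybe b e ∨ C.Yaf b e) ≡ true → I (ρB b) (ρE e) ≡ true

  -- Names: in C₂ the new event e is  zero  and an old event e' is  suc e';
  -- an old condition b is  k ↑ʳ b  and the new conditions (= e•) are
  -- i ↑ˡ nB  for i : Fin k.
  record Step (m₀ : MS nS) {nB nE k : ℕ}
              (C₁ : CNet nA nB nE) (ρ₁ : Folding N nB nE)
              (C₂ : CNet nA (k + nB) (suc nE)) (ρ₂ : Folding N (k + nB) (suc nE)) : Set where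
    private
      module C₁ = CNet C₁
      module C₂ = CNet C₂
      module ρ₁ = Folding ρ₁
      module ρ₂ = Folding ρ₂
      old : Fin nB → Fin (k + nB)
      old b = k ↑ʳ b
      new : Fin k → Fin (k + nB)
      new i = i ↑ˡ nB
    field
      proc₁ : IsProcess m₀ C₁ ρ₁
      proc₂ : IsProcess m₀ C₂ ρ₂
      pre-old   : ∀ e' b → C₂.pre (suc e') (old b) ≡ C₁.pre e' b
      post-old  : ∀ e' b → C₂.post (suc e') (old b) ≡ C₁.post e' b
      pre-old-new  : ∀ e' i → C₂.pre (suc e') (new i) ≡ false
      post-old-new : ∀ e' i → C₂.post (suc e') (new i) ≡ false
      lab-old   : ∀ e' → C₂.lab (suc e') ≡ C₁.lab e'
      pre-new-new : ∀ i → C₂.pre zero (new i) ≡ false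
      pre-new-max : ∀ b → C₂.pre zero (old b) ≡ true → isMax C₁ b ≡ true
      post-new-new : ∀ i → C₂.post zero (new i) ≡ true
      post-new-old : ∀ b → C₂.post zero (old b) ≡ false
      ρB-old : ∀ b → ρ₂.ρB (old b) ≡ ρ₁.ρB b
      ρE-old : ∀ e' → ρ₂.ρE (suc e') ≡ ρ₁.ρE e'
      A-max : ∀ b → isMax C₁ b ≡ true →
                (hasPost C₂ (old b) ∧ I (ρ₂.ρB (old b)) (ρ₂.ρE zero)) ≡ false
      Ybe-old-old : ∀ b e' → C₂.Ybe (old b) (suc e') ≡ C₁.Ybe b e'
      Ybe-new-old : ∀ i e' → C₂.Ybe (new i) (suc e') ≡ I (ρ₂.ρB (new i)) (ρ₂.ρE (suc e'))
      Ybe-new-ev  : ∀ b → C₂.Ybe b zero ≡ false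
      Yaf-old-old : ∀ b e' → C₂.Yaf (old b) (suc e') ≡ C₁.Yaf b e'
      Yaf-new-old : ∀ i e' → C₂.Yaf (new i) (suc e') ≡ false
      Yaf-new-ev  : ∀ b → C₂.Yaf b zero ≡ (hasPost C₂ b ∧ I (ρ₂.ρB b) (ρ₂.ρE zero))

  record Triple : Set where
    constructor triple
    field
      {nB nE} : ℕ
      ρ₁ : Folding N nB nE
      C  : CNet nA nB nE
      ρ₂ : Folding N nB nE

  IsCNBisim : (Triple → Set) → Set
  IsCNBisim R = ∀ {nB nE} (ρ₁ : Folding N nB nE) (C : CNet nA nB nE) (ρ₂ : Folding N nB nE) →
    R (triple ρ₁ C ρ₂) →
    ∃[ m₀₁ ] ∃[ m₀₂ ] (IsProcess m₀₁ C ρ₁ × IsProcess m₀₂ C ρ₂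
      × (∀ {k} (C' : CNet nA (k + nB) (suc nE)) (ρ₁' : Folding N (k + nB) (suc nE)) →
           Step m₀₁ C ρ₁ C' ρ₁' →
           ∃[ ρ₂' ] (Step m₀₂ C ρ₂ C' ρ₂' × R (triple ρ₁' C' ρ₂')))
      × (∀ {k} (C' : CNet nA (k + nB) (suc nE)) (ρ₂' : Folding N (k + nB) (suc nE)) →
           Step m₀₂ C ρ₂ C' ρ₂' →
           ∃[ ρ₁' ] (Step m₀₁ C ρ₁ C' ρ₁' × R (triple ρ₁' C' ρ₂'))))

  _∼cn_ : Marking N → Marking N → Set₁
  m₁ ∼cn m₂ = ∃[ R ] (IsCNBisim R × ∃[ x ] (R x × Initial x))
    where
      Initial : Triple → Set
      Initial (triple {nB} {nE} ρ₁ C ρ₂) =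
          nE ≡ 0
        × image ρ₁ (isMin C) ≡ m₁ × image ρ₁ (isMax C) ≡ m₁
        × image ρ₂ (isMin C) ≡ m₂ × image ρ₂ (isMax C) ≡ m₂

module Submission where

-- Let R be a pti-place bisimulation. Relate two processes (C, ρ₁), (C, ρ₂) with the same causal net
-- when ρ₁(b) R ρ₂(b) for every condition b and, for every event e, the places inhibiting ρ₁(e) and
-- ρ₂(e) correspond under R. If the first process grows by an event e with ρ₁(e) = t₁, then t₁ is
-- enabled at its own preset ρ₁(•e), which is R^⊕-related to ρ₂(•e); the place bisimulation answers
-- with a transition t₂ whose preset is exactly ρ₂(•e) and whose postset is R^⊕-related to that of
-- t₁, so matching e• place by place extends ρ₂. The initial triple is the eventless net obtained by
-- listing the places of a decomposition of (m₁, m₂) in R^⊕.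

open import Defs
open import Data.Nat using (ℕ; zero; suc; _+_; _∸_; _≤_; z≤n)
open import Data.Nat.Properties
  using ( +-assoc; +-comm; +-identityʳ; +-cancelˡ-≡; m≤m+n; m+[n∸m]≡n; m∸n≡0⇒m≤n; n∸n≡0
        ; ≤-antisym; ≤-refl; 0≢1+n; module ≤-Reasoning)
open import Data.Bool using (Bool; true; false; _∧_; _∨_; not; if_then_else_)
open import Data.Bool.Properties using (∧-identityʳ; ∧-zeroʳ; ⇔→≡)
open import Data.Fin using (Fin; zero; suc; _≟_; _↑ˡ_; _↑ʳ_; splitAt; join)
open import Data.Fin.Properties using (join-splitAt)
open import Data.Vec using (lookup; tabulate)
open import Data.Vec.Properties
  using (lookup-zipWith; lookup-replicate; lookup∘tabulate; tabulate∘lookup; tabulate-cong; zipWith-assoc; zipWith-comm)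
open import Data.Vec.Functional using (_∷_; _++_)
open import Data.Vec.Functional.Properties using (lookup-++ˡ; lookup-++ʳ)
open import Data.Product using (Σ; ∃-syntax; _×_; _,_; proj₁; proj₂)
open import Data.Sum using (inj₁; inj₂; [_,_])
open import Data.Empty using (⊥; ⊥-elim)
open import Relation.Nullary using (¬_; yes; no)
open import Relation.Nullary.Decidable using (⌊_⌋)
open import Relation.Binary.PropositionalEquality
  using (_≡_; _≢_; refl; sym; trans; cong; cong₂; subst; subst₂; module ≡-Reasoning)
open import Relation.Binary.Construct.Closure.Transitive as Plus using (TransClosure; [_])
open import Function using (_∘_; flip)
open import Function.Bundles using (_⇔_)
open import Function.Properties.Equivalence using () renaming (sym to ⇔-sym)

module _ {n : ℕ} where

  MS-ext : {x y : MS n} → (∀ s → lookup x s ≡ lookup y s) → x ≡ y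
  MS-ext {x} {y} p = trans (sym (tabulate∘lookup x)) (trans (tabulate-cong p) (tabulate∘lookup y))

  cong-lookup : ∀ {x y : MS n} (s : Fin n) → x ≡ y → lookup x s ≡ lookup y s
  cong-lookup s = cong (λ v → lookup v s)

  lookup-θ : (s : Fin n) → lookup (θ {n}) s ≡ 0
  lookup-θ s = lookup-replicate s 0

  lookup-⊕ : (x y : MS n) (s : Fin n) → lookup (x ⊕ y) s ≡ lookup x s + lookup y s
  lookup-⊕ x y s = lookup-zipWith _+_ s x y

  lookup-⊖ : (x y : MS n) (s : Fin n) → lookup (x ⊖ y) s ≡ lookup x s ∸ lookup y s
  lookup-⊖ x y s = lookup-zipWith _∸_ s x y

  lookup-⟦⟧ : (a s : Fin n) → lookup ⟦ a ⟧ s ≡ (if ⌊ a ≟ s ⌋ then 1 else 0)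
  lookup-⟦⟧ a = lookup∘tabulate _

  lookup-⟦⟧-self : (a : Fin n) → lookup ⟦ a ⟧ a ≡ 1
  lookup-⟦⟧-self a with a ≟ a | lookup-⟦⟧ a a
  ... | yes _   | eq = eq
  ... | no a≢a  | _  = ⊥-elim (a≢a refl)

  lookup-⟦⟧-other : {a s : Fin n} → a ≢ s → lookup ⟦ a ⟧ s ≡ 0
  lookup-⟦⟧-other {a} {s} a≢s with a ≟ s | lookup-⟦⟧ a s
  ... | yes a≡s | _  = ⊥-elim (a≢s a≡s)
  ... | no _    | eq = eq

  ⊕-comm : (x y : MS n) → x ⊕ y ≡ y ⊕ x
  ⊕-comm = zipWith-comm +-comm

  ⊕-assoc : (x y z : MS n) → (x ⊕ y) ⊕ z ≡ x ⊕ (y ⊕ z)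
  ⊕-assoc = zipWith-assoc +-assoc

  ⊕-swap : (x y z : MS n) → x ⊕ (y ⊕ z) ≡ y ⊕ (x ⊕ z)
  ⊕-swap x y z = trans (sym (⊕-assoc x y z)) (trans (cong (_⊕ z) (⊕-comm x y)) (⊕-assoc y x z))

  ⊕-cancelˡ : (x : MS n) {y z : MS n} → x ⊕ y ≡ x ⊕ z → y ≡ z
  ⊕-cancelˡ x {y} {z} eq = MS-ext λ s →
    +-cancelˡ-≡ (lookup x s) _ _ (trans (sym (lookup-⊕ x y s)) (trans (cong-lookup s eq) (lookup-⊕ x z s)))

  ⊕-⊖-inverse : {x y : MS n} → x ⊆ y → x ⊕ (y ⊖ x) ≡ y
  ⊕-⊖-inverse {x} {y} x⊆y = MS-ext λ s → trans (lookup-⊕ x (y ⊖ x) s)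
    (trans (cong (lookup x s +_) (lookup-⊖ y x s)) (m+[n∸m]≡n (x⊆y s)))

  ⊖-self : (x : MS n) → x ⊖ x ≡ θ
  ⊖-self x = MS-ext λ s → trans (lookup-⊖ x x s) (trans (n∸n≡0 (lookup x s)) (sym (lookup-θ s)))

  ⊆-antisym-⊖ : {x y : MS n} → x ⊆ y → y ⊖ x ≡ θ → x ≡ y
  ⊆-antisym-⊖ {x} {y} x⊆y y⊖x≡θ = MS-ext λ s → ≤-antisym (x⊆y s)
    (m∸n≡0⇒m≤n (trans (sym (lookup-⊖ y x s)) (trans (cong-lookup s y⊖x≡θ) (lookup-θ s))))

  θ≢⟦⟧⊕ : {a : Fin n} {m : MS n} → θ ≢ ⟦ a ⟧ ⊕ m
  θ≢⟦⟧⊕ {a} {m} eq = 0≢1+n (begin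
    0                            ≡⟨ sym (lookup-θ a) ⟩
    lookup θ a                   ≡⟨ cong-lookup a eq ⟩
    lookup (⟦ a ⟧ ⊕ m) a         ≡⟨ lookup-⊕ ⟦ a ⟧ m a ⟩
    lookup ⟦ a ⟧ a + lookup m a  ≡⟨ cong (_+ lookup m a) (lookup-⟦⟧-self a) ⟩
    suc (lookup m a)             ∎)
    where open ≡-Reasoning

  ⟦⟧⊆-of-⊕ : {a b : Fin n} {m M : MS n} → a ≢ b → ⟦ a ⟧ ⊕ m ≡ ⟦ b ⟧ ⊕ M → ⟦ a ⟧ ⊆ M
  ⟦⟧⊆-of-⊕ {a} {b} {m} {M} a≢b eq s with a ≟ s
  ... | no a≢s = subst (_≤ lookup M s) (sym (lookup-⟦⟧-other a≢s)) z≤n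
  ... | yes refl = begin
    lookup ⟦ a ⟧ a                 ≤⟨ m≤m+n _ _ ⟩
    lookup ⟦ a ⟧ a + lookup m a    ≡⟨ sym (lookup-⊕ ⟦ a ⟧ m a) ⟩
    lookup (⟦ a ⟧ ⊕ m) a           ≡⟨ cong-lookup a eq ⟩
    lookup (⟦ b ⟧ ⊕ M) a           ≡⟨ lookup-⊕ ⟦ b ⟧ M a ⟩
    lookup ⟦ b ⟧ a + lookup M a    ≡⟨ cong (_+ lookup M a) (lookup-⟦⟧-other (a≢b ∘ sym)) ⟩
    lookup M a                     ∎
    where open ≤-Reasoning

count-cong : ∀ {n} {f g : Fin n → Bool} → (∀ i → f i ≡ g i) → count f ≡ count g
count-cong {zero}  p = refl
count-cong {suc n} p = cong₂ _+_ (cong (if_then 1 else 0) (p zero)) (count-cong (p ∘ suc))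

anyB-cong : ∀ {n} {f g : Fin n → Bool} → (∀ i → f i ≡ g i) → anyB f ≡ anyB g
anyB-cong {zero}  p = refl
anyB-cong {suc n} p = cong₂ _∨_ (p zero) (anyB-cong (p ∘ suc))

count-none : ∀ {n} {f : Fin n → Bool} → (∀ i → f i ≡ false) → count f ≡ 0
count-none {zero}  p = refl
count-none {suc n} p = cong₂ _+_ (cong (if_then 1 else 0) (p zero)) (count-none (p ∘ suc))

count-++ : ∀ k {n} (f : Fin (k + n) → Bool) → count f ≡ count (f ∘ (_↑ˡ n)) + count (f ∘ (k ↑ʳ_))
count-++ zero    f = refl
count-++ (suc k) f = trans (cong (first +_) (count-++ k (f ∘ suc))) (sym (+-assoc first _ _))
  where first = if f zero then 1 else 0

↑-split : ∀ k {n} (P : Fin (k + n) → Set) → (∀ i → P (i ↑ˡ n)) → (∀ b → P (k ↑ʳ b)) → ∀ x → P x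
↑-split k {n} P new old x = subst P (join-splitAt k n x) ([_,_] {C = P ∘ join k n} new old (splitAt k x))

-- Defs.image, for an arbitrary map in place of a folding.
img : ∀ {nS n} → (Fin n → Fin nS) → (Fin n → Bool) → MS nS
img f X = tabulate (λ s → count (λ b → ⌊ f b ≟ s ⌋ ∧ X b))

full : ∀ {n} → Fin n → Bool
full _ = true

module _ {nS : ℕ} where

  lookup-img : ∀ {n} (f : Fin n → Fin nS) (X : Fin n → Bool) s →
               lookup (img f X) s ≡ count (λ b → ⌊ f b ≟ s ⌋ ∧ X b)
  lookup-img f X = lookup∘tabulate _

  img-cong : ∀ {n} {f g : Fin n → Fin nS} {X Y : Fin n → Bool} →
             (∀ b → f b ≡ g b) → (∀ b → X b ≡ Y b) → img f X ≡ img g Y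
  img-cong f≗g X≗Y = tabulate-cong λ s → count-cong λ b → cong₂ (λ a x → ⌊ a ≟ s ⌋ ∧ x) (f≗g b) (X≗Y b)

  img-[] : (f : Fin 0 → Fin nS) (X : Fin 0 → Bool) → img f X ≡ θ
  img-[] f X = MS-ext λ s → trans (lookup-img f X s) (sym (lookup-θ s))

  img-∷ : ∀ {n} (f : Fin (suc n) → Fin nS) (X : Fin (suc n) → Bool) →
          X zero ≡ true → img f X ≡ ⟦ f zero ⟧ ⊕ img (f ∘ suc) (X ∘ suc)
  img-∷ f X X₀ = MS-ext λ s → begin
    lookup (img f X) s
      ≡⟨ lookup-img f X s ⟩
    (if ⌊ f zero ≟ s ⌋ ∧ X zero then 1 else 0) + count (λ b → ⌊ f (suc b) ≟ s ⌋ ∧ X (suc b))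
      ≡⟨ cong₂ _+_ (head-count s) (sym (lookup-img (f ∘ suc) (X ∘ suc) s)) ⟩
    lookup ⟦ f zero ⟧ s + lookup (img (f ∘ suc) (X ∘ suc)) s
      ≡⟨ sym (lookup-⊕ ⟦ f zero ⟧ (img (f ∘ suc) (X ∘ suc)) s) ⟩
    lookup (⟦ f zero ⟧ ⊕ img (f ∘ suc) (X ∘ suc)) s ∎
    where
      open ≡-Reasoning
      head-count : ∀ s → (if ⌊ f zero ≟ s ⌋ ∧ X zero then 1 else 0) ≡ lookup ⟦ f zero ⟧ s
      head-count s = trans (cong (if_then 1 else 0) (trans (cong (⌊ f zero ≟ s ⌋ ∧_) X₀) (∧-identityʳ _)))
                           (sym (lookup-⟦⟧ (f zero) s))

  img-skip : ∀ {n} (f : Fin (suc n) → Fin nS) (X : Fin (suc n) → Bool) →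
             X zero ≡ false → img f X ≡ img (f ∘ suc) (X ∘ suc)
  img-skip f X X₀ = tabulate-cong λ s →
    cong (λ c → (if c then 1 else 0) + count (λ b → ⌊ f (suc b) ≟ s ⌋ ∧ X (suc b)))
         (trans (cong (⌊ f zero ≟ s ⌋ ∧_) X₀) (∧-zeroʳ _))

  img-↑ʳ : ∀ k {n} (f : Fin (k + n) → Fin nS) (X : Fin (k + n) → Bool) {g : Fin n → Fin nS} {Y : Fin n → Bool} →
           (∀ i → X (i ↑ˡ n) ≡ false) → (∀ b → f (k ↑ʳ b) ≡ g b) → (∀ b → X (k ↑ʳ b) ≡ Y b) →
           img f X ≡ img g Y
  img-↑ʳ k {n} f X X-new f-old X-old = trans (tabulate-cong old-part) (img-cong f-old X-old)
    where
      old-part : ∀ s → count (λ b → ⌊ f b ≟ s ⌋ ∧ X b) ≡ count (λ b → ⌊ f (k ↑ʳ b) ≟ s ⌋ ∧ X (k ↑ʳ b))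
      old-part s = trans (count-++ k (λ b → ⌊ f b ≟ s ⌋ ∧ X b))
        (cong (_+ count (λ b → ⌊ f (k ↑ʳ b) ≟ s ⌋ ∧ X (k ↑ʳ b)))
              (count-none λ i → trans (cong (⌊ f (i ↑ˡ n) ≟ s ⌋ ∧_) (X-new i)) (∧-zeroʳ _)))

  img-↑ˡ : ∀ k {n} (f : Fin (k + n) → Fin nS) (X : Fin (k + n) → Bool) {g : Fin k → Fin nS} →
           (∀ i → X (i ↑ˡ n) ≡ true) → (∀ b → X (k ↑ʳ b) ≡ false) → (∀ i → f (i ↑ˡ n) ≡ g i) →
           img f X ≡ img g full
  img-↑ˡ k {n} f X X-new X-old f-new = trans (tabulate-cong new-part) (img-cong f-new X-new)
    where
      new-part : ∀ s → count (λ b → ⌊ f b ≟ s ⌋ ∧ X b) ≡ count (λ i → ⌊ f (i ↑ˡ n) ≟ s ⌋ ∧ X (i ↑ˡ n))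
      new-part s = trans (count-++ k (λ b → ⌊ f b ≟ s ⌋ ∧ X b))
        (trans (cong (count (λ i → ⌊ f (i ↑ˡ n) ≟ s ⌋ ∧ X (i ↑ˡ n)) +_)
                     (count-none λ b → trans (cong (⌊ f (k ↑ʳ b) ≟ s ⌋ ∧_) (X-old b)) (∧-zeroʳ _)))
               (+-identityʳ _))

module _ {N : PTINet} where
  open PTINet N using (nS)

  private
    Place = Fin nS

  Lift-flip : ∀ {R : Place → Place → Set} {x y} → Lift N R x y → Lift N (flip R) y x
  Lift-flip nil        = nil
  Lift-flip (cons r l) = cons r (Lift-flip l)

  Lift-θ : ∀ {R} {x y} → Lift N R x y → x ≡ θ → y ≡ θ
  Lift-θ nil        _   = refl
  Lift-θ (cons _ _) x≡θ = ⊥-elim (θ≢⟦⟧⊕ (sym x≡θ))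

  Lift-extract : ∀ {R} {x y a M} → Lift N R x y → x ≡ ⟦ a ⟧ ⊕ M →
                 Σ Place λ b → Σ (MS nS) λ M' → R a b × y ≡ ⟦ b ⟧ ⊕ M' × Lift N R M M'
  Lift-extract nil eq = ⊥-elim (θ≢⟦⟧⊕ eq)
  Lift-extract {R} {a = a} {M} (cons {s₁} {s₂} {m₁} {m₂} r l) eq with s₁ ≟ a
  ... | yes refl = s₂ , m₂ , r , refl , subst (λ m → Lift N R m m₂) (⊕-cancelˡ ⟦ s₁ ⟧ eq) l
  ... | no s₁≢a = prepend (Lift-extract l m₁≡a⊕M')
    where
      open ≡-Reasoning
      M' = M ⊖ ⟦ s₁ ⟧

      s₁⊕M'≡M : ⟦ s₁ ⟧ ⊕ M' ≡ M
      s₁⊕M'≡M = ⊕-⊖-inverse (⟦⟧⊆-of-⊕ s₁≢a eq)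

      m₁≡a⊕M' : m₁ ≡ ⟦ a ⟧ ⊕ M'
      m₁≡a⊕M' = ⊕-cancelˡ ⟦ s₁ ⟧ (begin
        ⟦ s₁ ⟧ ⊕ m₁            ≡⟨ eq ⟩
        ⟦ a ⟧ ⊕ M              ≡⟨ cong (⟦ a ⟧ ⊕_) (sym s₁⊕M'≡M) ⟩
        ⟦ a ⟧ ⊕ (⟦ s₁ ⟧ ⊕ M')  ≡⟨ ⊕-swap ⟦ a ⟧ ⟦ s₁ ⟧ M' ⟩
        ⟦ s₁ ⟧ ⊕ (⟦ a ⟧ ⊕ M')  ∎)

      prepend : (Σ Place λ b → Σ (MS nS) λ M'' → R a b × m₂ ≡ ⟦ b ⟧ ⊕ M'' × Lift N R M' M'') →
                Σ Place λ b → Σ (MS nS) λ M'' → R a b × ⟦ s₂ ⟧ ⊕ m₂ ≡ ⟦ b ⟧ ⊕ M'' × Lift N R M M''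
      prepend (b , M'' , r' , m₂≡b⊕M'' , l') =
        b , ⟦ s₂ ⟧ ⊕ M'' , r' ,
        trans (cong (⟦ s₂ ⟧ ⊕_) m₂≡b⊕M'') (⊕-swap ⟦ s₂ ⟧ ⟦ b ⟧ M'') ,
        subst (λ m → Lift N R m (⟦ s₂ ⟧ ⊕ M'')) s₁⊕M'≡M (cons r l')

  img-Lift : ∀ {R : Place → Place → Set} {n} {f₁ f₂ : Fin n → Place} (X : Fin n → Bool) →
             (∀ b → R (f₁ b) (f₂ b)) → Lift N R (img f₁ X) (img f₂ X)
  img-Lift {R} {zero} {f₁} {f₂} X _ = subst₂ (Lift N R) (sym (img-[] f₁ X)) (sym (img-[] f₂ X)) nil
  img-Lift {R} {suc n} {f₁} {f₂} X rs = by-head (X zero) refl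
    where
      tail-Lift : Lift N R (img (f₁ ∘ suc) (X ∘ suc)) (img (f₂ ∘ suc) (X ∘ suc))
      tail-Lift = img-Lift (X ∘ suc) (rs ∘ suc)

      by-head : ∀ c → X zero ≡ c → Lift N R (img f₁ X) (img f₂ X)
      by-head true  X₀ = subst₂ (Lift N R) (sym (img-∷ f₁ X X₀)) (sym (img-∷ f₂ X X₀)) (cons (rs zero) tail-Lift)
      by-head false X₀ = subst₂ (Lift N R) (sym (img-skip f₁ X X₀)) (sym (img-skip f₂ X X₀)) tail-Lift

  Lift-enumerate : ∀ {R : Place → Place → Set} {m₁ m₂} → Lift N R m₁ m₂ →
    Σ ℕ λ n → Σ (Fin n → Place) λ f₁ → Σ (Fin n → Place) λ f₂ →
      (∀ i → R (f₁ i) (f₂ i)) × img f₁ full ≡ m₁ × img f₂ full ≡ m₂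
  Lift-enumerate nil = 0 , (λ ()) , (λ ()) , (λ ()) , img-[] (λ ()) full , img-[] (λ ()) full
  Lift-enumerate (cons {s₁} {s₂} r l) with Lift-enumerate l
  ... | n , f₁ , f₂ , rs , refl , refl =
    suc n , s₁ ∷ f₁ , s₂ ∷ f₂ , (λ { zero → r ; (suc i) → rs i }) ,
    img-∷ (s₁ ∷ f₁) full refl , img-∷ (s₂ ∷ f₂) full refl

  Lift-img-match : ∀ {R : Place → Place → Set} {k} (g₁ : Fin k → Place) {M} → Lift N R (img g₁ full) M →
    Σ (Fin k → Place) λ g₂ → (∀ i → R (g₁ i) (g₂ i)) × img g₂ full ≡ M
  Lift-img-match {k = zero} g₁ l = (λ ()) , (λ ()) , trans (img-[] (λ ()) full) (sym (Lift-θ l (img-[] g₁ full)))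
  Lift-img-match {k = suc k} g₁ l with Lift-extract l (img-∷ g₁ full refl)
  ... | b , M' , r , refl , l' with Lift-img-match (g₁ ∘ suc) l'
  ... | g₂ , rs , refl = b ∷ g₂ , (λ { zero → r ; (suc i) → rs i }) , img-∷ (b ∷ g₂) full refl

module _ {nA nB nE : ℕ} {C : CNet nA nB nE} (causal : IsCausal C) where
  open CNet C
  open IsCausal causal

  preset-arc-cyclic : ∀ {b e} → pre e b ≡ true → (Ybe b e ∨ Yaf b e ∨ post e b) ≡ true → ⊥
  preset-arc-cyclic {b} {e} b∈•e arc with Ybe b e in before | Yaf b e in after | post e b in b∈e•
  ... | true | _ | _ with Ybe-ok b e before
  ...   | e' , b∈e'• = acyclic (inj₂ e) (be b b∈e'• before Plus.∷ flow-out b∈e'• Plus.∷ [ flow-in b∈•e ])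
  preset-arc-cyclic b∈•e _ | false | true  | _    = acyclic (inj₂ _) [ af _ b∈•e after ]
  preset-arc-cyclic b∈•e _ | false | false | true = acyclic (inj₁ _) (flow-in b∈•e Plus.∷ [ flow-out b∈e• ])

eventless : ∀ {nA} n → CNet nA n 0
eventless n = record { pre = λ () ; post = λ () ; lab = λ () ; Ybe = λ _ () ; Yaf = λ _ () }

eventless-causal : ∀ {nA n} → IsCausal (eventless {nA} n)
eventless-causal {nA} {n} = record
  { pre-cond-unique  = λ _ ()
  ; post-cond-unique = λ _ ()
  ; Ybe-ok           = λ _ ()
  ; Yaf-ok           = λ _ ()
  ; acyclic          = λ _ → no-path
  }
  where
    no-order : ∀ {x y} → ¬ Order (eventless {nA} n) x y
    no-order (flow-in {e = ()} _)
    no-order (flow-out {e = ()} _)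
    no-order (af {e = ()} _ _ _)
    no-order (be {e = ()} _ _ _)

    no-path : ∀ {x y} → ¬ TransClosure (Order (eventless {nA} n)) x y
    no-path [ o ]         = no-order o
    no-path (o Plus.∷ _)  = no-order o

module _ {N : PTINet} where
  open PTINet N
  open Folding

  private
    Place = Fin nS

  module _ {m₀ nB nE} {C : CNet nA nB nE} {ρ : Folding N nB nE} (P : IsProcess N m₀ C ρ) where
    private
      module C = CNet C
    open IsProcess P

    init-img : img (ρB ρ) (isMin C) ≡ m₀
    init-img = MS-ext λ s → trans (lookup-img (ρB ρ) (isMin C) s) (sym (init-ok s))

    pre-img : ∀ e → pre (ρE ρ e) ≡ img (ρB ρ) (C.pre e)
    pre-img e = MS-ext λ s → trans (pre-ok e s) (sym (lookup-img (ρB ρ) (C.pre e) s))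

    post-img : ∀ e → post (ρE ρ e) ≡ img (ρB ρ) (C.post e)
    post-img e = MS-ext λ s → trans (post-ok e s) (sym (lookup-img (ρB ρ) (C.post e) s))

    -- No condition of •e can be inhibiting for e: that would close a cycle in the causal net.
    enabled-at-preset : ∀ e → Enabled N (ρE ρ e) (pre (ρE ρ e))
    enabled-at-preset e = (λ s → ≤-refl) , λ s inhibits → trans (pre-ok e s) (count-none (unblocked s inhibits))
      where
        unblocked : ∀ s → I s (ρE ρ e) ≡ true → ∀ b → (⌊ ρB ρ b ≟ s ⌋ ∧ C.pre e b) ≡ false
        unblocked s inhibits b with ρB ρ b ≟ s | C.pre e b in b∈•e
        ... | no _     | _     = refl
        ... | yes _    | false = refl
        ... | yes ρb≡s | true  = ⊥-elim (preset-arc-cyclic causal b∈•e (inh-ok s e inhibits b ρb≡s))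

  SameInhibition : ∀ {nB nE} → Folding N nB nE → Folding N nB nE → Set
  SameInhibition ρ₁ ρ₂ = ∀ b e → I (ρB ρ₁ b) (ρE ρ₁ e) ≡ I (ρB ρ₂ b) (ρE ρ₂ e)

  IsProcess-transfer : ∀ {m₀ m₀' nB nE} {C : CNet nA nB nE} {ρ₁ ρ₂ : Folding N nB nE} →
    IsProcess N m₀ C ρ₁ → SameInhibition ρ₁ ρ₂ →
    (∀ e → CNet.lab C e ≡ lab (ρE ρ₂ e)) →
    img (ρB ρ₂) (isMin C) ≡ m₀' →
    (∀ e → pre (ρE ρ₂ e) ≡ img (ρB ρ₂) (CNet.pre C e)) →
    (∀ e → post (ρE ρ₂ e) ≡ img (ρB ρ₂) (CNet.post C e)) →
    IsProcess N m₀' C ρ₂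
  IsProcess-transfer {C = C} {ρ₁} {ρ₂} P same labels init pres posts = record
    { causal  = causal
    ; lab-ok  = labels
    ; init-ok = λ s → trans (sym (cong-lookup s init)) (lookup-img (ρB ρ₂) (isMin C) s)
    ; pre-ok  = λ e s → trans (cong-lookup s (pres e)) (lookup-img (ρB ρ₂) (CNet.pre C e) s)
    ; post-ok = λ e s → trans (cong-lookup s (posts e)) (lookup-img (ρB ρ₂) (CNet.post C e) s)
    ; inh-ok  = λ { s e inhibits b refl → inh-ok (ρB ρ₁ b) e (trans (same b e) inhibits) b refl }
    ; Y-ok    = λ b e y → trans (sym (same b e)) (Y-ok b e y)
    }
    where open IsProcess P

  extend : ∀ {k nB nE} → (Fin k → Place) → Fin nT → Folding N nB nE → Folding N (k + nB) (suc nE)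
  extend g t ρ = record { ρB = g ++ ρB ρ ; ρE = t ∷ ρE ρ }

  module _ {m₀ nB nE k} {C : CNet nA nB nE} {ρ : Folding N nB nE}
           {C' : CNet nA (k + nB) (suc nE)} {ρ' : Folding N (k + nB) (suc nE)}
           (st : Step N m₀ C ρ C' ρ') where
    open Step st

    isMin-new : ∀ i → isMin C' (i ↑ˡ nB) ≡ false
    isMin-new i = cong (λ c → not (c ∨ anyB (λ e → CNet.post C' (suc e) (i ↑ˡ nB)))) (post-new-new i)

    isMin-old : ∀ b → isMin C' (k ↑ʳ b) ≡ isMin C b
    isMin-old b = cong₂ (λ c d → not (c ∨ d)) (post-new-old b) (anyB-cong λ e → post-old e b)

    Step-transfer : ∀ {m₀'} {ρ₂ : Folding N nB nE} {ρ₂' : Folding N (k + nB) (suc nE)} →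
      IsProcess N m₀' C ρ₂ → IsProcess N m₀' C' ρ₂' →
      (∀ b → ρB ρ₂' (k ↑ʳ b) ≡ ρB ρ₂ b) → (∀ e → ρE ρ₂' (suc e) ≡ ρE ρ₂ e) →
      SameInhibition ρ' ρ₂' → Step N m₀' C ρ₂ C' ρ₂'
    Step-transfer P₂ P₂' ρB-old₂ ρE-old₂ same = record
      { proc₁        = P₂
      ; proc₂        = P₂'
      ; pre-old      = pre-old
      ; post-old     = post-old
      ; pre-old-new  = pre-old-new
      ; post-old-new = post-old-new
      ; lab-old      = lab-old
      ; pre-new-new  = pre-new-new
      ; pre-new-max  = pre-new-max
      ; post-new-new = post-new-new
      ; post-new-old = post-new-old
      ; ρB-old       = ρB-old₂
      ; ρE-old       = ρE-old₂
      ; A-max        = λ b max → trans (cong (hasPost C' (k ↑ʳ b) ∧_) (sym (same (k ↑ʳ b) zero))) (A-max b max)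
      ; Ybe-old-old  = Ybe-old-old
      ; Ybe-new-old  = λ i e → trans (Ybe-new-old i e) (same (i ↑ˡ nB) (suc e))
      ; Ybe-new-ev   = Ybe-new-ev
      ; Yaf-old-old  = Yaf-old-old
      ; Yaf-new-old  = Yaf-new-old
      ; Yaf-new-ev   = λ b → trans (Yaf-new-ev b) (cong (hasPost C' b ∧_) (same b zero))
      }

    extend-process : ∀ {m₀'} {ρ₂ : Folding N nB nE} {g t} →
      IsProcess N m₀' C ρ₂ → SameInhibition ρ' (extend g t ρ₂) →
      lab (ρE ρ' zero) ≡ lab t →
      pre t ≡ img (ρB ρ₂) (λ b → CNet.pre C' zero (k ↑ʳ b)) →
      post t ≡ img g full →
      IsProcess N m₀' C' (extend g t ρ₂)
    extend-process {ρ₂ = ρ₂} {g} {t} P₂ same label preset postset =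
      IsProcess-transfer proc₂ same labels (trans (old-img isMin-new isMin-old) (init-img P₂)) pres posts
      where
        ρ₂' = extend g t ρ₂

        old-img : ∀ {X' : Fin (k + nB) → Bool} {X} → (∀ i → X' (i ↑ˡ nB) ≡ false) → (∀ b → X' (k ↑ʳ b) ≡ X b) →
                  img (ρB ρ₂') X' ≡ img (ρB ρ₂) X
        old-img {X'} X'-new X'-old = img-↑ʳ k (ρB ρ₂') X' X'-new (lookup-++ʳ g (ρB ρ₂)) X'-old

        labels : ∀ e → CNet.lab C' e ≡ lab (ρE ρ₂' e)
        labels zero    = trans (IsProcess.lab-ok proc₂ zero) label
        labels (suc e) = trans (lab-old e) (IsProcess.lab-ok P₂ e)

        pres : ∀ e → pre (ρE ρ₂' e) ≡ img (ρB ρ₂') (CNet.pre C' e)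
        pres zero    = trans preset (sym (old-img pre-new-new (λ _ → refl)))
        pres (suc e) = trans (pre-img P₂ e) (sym (old-img (pre-old-new e) (pre-old e)))

        posts : ∀ e → post (ρE ρ₂' e) ≡ img (ρB ρ₂') (CNet.post C' e)
        posts zero    = trans postset (sym (img-↑ˡ k (ρB ρ₂') (CNet.post C' zero) post-new-new post-new-old
                                                   (lookup-++ˡ g (ρB ρ₂))))
        posts (suc e) = trans (post-img P₂ e) (sym (old-img (post-old-new e) (post-old e)))

  PlaceSimulation : (Place → Place → Set) → Set
  PlaceSimulation R = ∀ m₁ m₂ → Lift N R m₁ m₂ → ∀ t₁ m₁' → Fires N m₁ t₁ m₁' →
                      ∃[ t₂ ] ∃[ m₂' ] (Fires N m₂ t₂ m₂' × Match N R m₁ t₁ m₂ t₂)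

  place-bisim⇒simulation : ∀ {R} → IsPtiPlaceBisim N R → PlaceSimulation R
  place-bisim⇒simulation bisim m₁ m₂ l = proj₁ (bisim m₁ m₂ l)

  place-bisim⇒simulation⁻¹ : ∀ {R} → IsPtiPlaceBisim N R → PlaceSimulation (flip R)
  place-bisim⇒simulation⁻¹ bisim m₂ m₁ l t₂ m₂' fires
    with proj₂ (bisim m₁ m₂ (Lift-flip l)) t₂ m₂' fires
  ... | t₁ , m₁' , fires₁ , (pres , posts , labels , rests , inhibitors) =
    t₁ , m₁' , fires₁ ,
    (Lift-flip pres , Lift-flip posts , sym labels , Lift-flip rests , λ s s' r → ⇔-sym (inhibitors s' s r))

  record MatchingTransition (R : Place → Place → Set) (t₁ : Fin nT) (M : MS nS) : Set where
    field
      t₂         : Fin nT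
      preset     : pre t₂ ≡ M
      postset    : Lift N R (post t₁) (post t₂)
      label      : lab t₁ ≡ lab t₂
      inhibition : ∀ s s' → R s s' → (I s t₁ ≡ true ⇔ I s' t₂ ≡ true)

  -- Firing t₁ from exactly its preset leaves nothing behind, so the answer consumes all of M.
  match-from-preset : ∀ {R t₁ M} → PlaceSimulation R → Lift N R (pre t₁) M → Enabled N t₁ (pre t₁) →
                      MatchingTransition R t₁ M
  match-from-preset {t₁ = t₁} sim l enabled with sim _ _ l t₁ _ (enabled , refl)
  ... | t₂ , _ , ((pre⊆M , _) , _) , (_ , posts , labels , rests , inhibitors) = record
    { t₂         = t₂
    ; preset     = ⊆-antisym-⊖ pre⊆M (Lift-θ rests (⊖-self (pre t₁)))
    ; postset    = posts
    ; label      = labels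
    ; inhibition = inhibitors
    }

  InhibitionRelated : ∀ {nB nE} → (Place → Place → Set) → Folding N nB nE → Folding N nB nE → Set
  InhibitionRelated R ρ₁ ρ₂ = ∀ e s s' → R s s' → (I s (ρE ρ₁ e) ≡ true ⇔ I s' (ρE ρ₂ e) ≡ true)

  inhibition-agree : ∀ {R nB nE} {ρ₁ ρ₂ : Folding N nB nE} →
    (∀ b → R (ρB ρ₁ b) (ρB ρ₂ b)) → InhibitionRelated R ρ₁ ρ₂ → SameInhibition ρ₁ ρ₂
  inhibition-agree conditions events b e = ⇔→≡ (events e _ _ (conditions b))

  record Related (R : Place → Place → Set) (m₁ m₂ : Marking N) {nB nE}
                 (ρ₁ : Folding N nB nE) (C : CNet nA nB nE) (ρ₂ : Folding N nB nE) : Set where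
    field
      process₁   : IsProcess N m₁ C ρ₁
      process₂   : IsProcess N m₂ C ρ₂
      conditions : ∀ b → R (ρB ρ₁ b) (ρB ρ₂ b)
      events     : InhibitionRelated R ρ₁ ρ₂

  Related-flip : ∀ {R m₁ m₂ nB nE} {ρ₁ : Folding N nB nE} {C} {ρ₂} →
                 Related R m₁ m₂ ρ₁ C ρ₂ → Related (flip R) m₂ m₁ ρ₂ C ρ₁
  Related-flip rel = record
    { process₁   = process₂
    ; process₂   = process₁
    ; conditions = conditions
    ; events     = λ e s s' r → ⇔-sym (events e s' s r)
    }
    where open Related rel

  simulate : ∀ {R} → PlaceSimulation R → ∀ {m₁ m₂ nB nE k} {ρ₁ ρ₂ : Folding N nB nE} {C : CNet nA nB nE}
             {C' : CNet nA (k + nB) (suc nE)} {ρ₁' : Folding N (k + nB) (suc nE)} →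
             Related R m₁ m₂ ρ₁ C ρ₂ → Step N m₁ C ρ₁ C' ρ₁' →
             ∃[ ρ₂' ] (Step N m₂ C ρ₂ C' ρ₂' × Related R m₁ m₂ ρ₁' C' ρ₂')
  simulate {R} sim {m₂ = m₂} {nB} {nE} {k} {ρ₁} {ρ₂} {C' = C'} {ρ₁'} rel st =
    ρ₂' , Step-transfer st process₂ process₂' (lookup-++ʳ new₂ (ρB ρ₂)) (λ _ → refl) same' ,
    record { process₁ = St.proc₂ ; process₂ = process₂' ; conditions = conditions' ; events = events' }
    where
      open Related rel
      module St = Step st

      t₁ : Fin nT
      t₁ = ρE ρ₁' zero

      •e : Fin nB → Bool
      •e b = CNet.pre C' zero (k ↑ʳ b)

      preset₁ : pre t₁ ≡ img (ρB ρ₁) •e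
      preset₁ = trans (pre-img St.proc₂ zero)
                      (img-↑ʳ k (ρB ρ₁') (CNet.pre C' zero) St.pre-new-new St.ρB-old (λ _ → refl))

      new₁ : Fin k → Place
      new₁ i = ρB ρ₁' (i ↑ˡ nB)

      postset₁ : post t₁ ≡ img new₁ full
      postset₁ = trans (post-img St.proc₂ zero)
                       (img-↑ˡ k (ρB ρ₁') (CNet.post C' zero) St.post-new-new St.post-new-old (λ _ → refl))

      answer : MatchingTransition R t₁ (img (ρB ρ₂) •e)
      answer = match-from-preset sim
        (subst (λ m → Lift N R m (img (ρB ρ₂) •e)) (sym preset₁) (img-Lift •e conditions))
        (enabled-at-preset St.proc₂ zero)
      open MatchingTransition answer

      matched : Σ (Fin k → Place) λ g₂ → (∀ i → R (new₁ i) (g₂ i)) × img g₂ full ≡ post t₂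
      matched = Lift-img-match new₁ (subst (λ m → Lift N R m (post t₂)) postset₁ postset)

      new₂ : Fin k → Place
      new₂ = proj₁ matched

      ρ₂' : Folding N (k + nB) (suc nE)
      ρ₂' = extend new₂ t₂ ρ₂

      conditions' : ∀ x → R (ρB ρ₁' x) (ρB ρ₂' x)
      conditions' = ↑-split k _
        (λ i → subst (R _) (sym (lookup-++ˡ new₂ (ρB ρ₂) i)) (proj₁ (proj₂ matched) i))
        (λ b → subst₂ R (sym (St.ρB-old b)) (sym (lookup-++ʳ new₂ (ρB ρ₂) b)) (conditions b))

      events' : InhibitionRelated R ρ₁' ρ₂'
      events' zero    = inhibition
      events' (suc e) = subst (λ t → ∀ s s' → R s s' → (I s t ≡ true ⇔ _)) (sym (St.ρE-old e)) (events e)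

      same' : SameInhibition ρ₁' ρ₂'
      same' = inhibition-agree conditions' events'

      process₂' : IsProcess N m₂ C' ρ₂'
      process₂' = extend-process st process₂ same' label preset (sym (proj₂ (proj₂ matched)))

  RelatedTriple : (Place → Place → Set) → Marking N → Marking N → Triple N → Set
  RelatedTriple R m₁ m₂ (triple ρ₁ C ρ₂) = Related R m₁ m₂ ρ₁ C ρ₂

  Related-isCNBisim : ∀ {R m₁ m₂} → IsPtiPlaceBisim N R → IsCNBisim N (RelatedTriple R m₁ m₂)
  Related-isCNBisim {R} {m₁} {m₂} bisim {nB} {nE} ρ₁ C ρ₂ rel =
    m₁ , m₂ , process₁ , process₂ ,
    (λ C' ρ₁' step → simulate (place-bisim⇒simulation bisim) rel step) ,
    (λ C' ρ₂' step → unflip (simulate (place-bisim⇒simulation⁻¹ bisim) (Related-flip rel) step))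
    where
      open Related rel
      unflip : ∀ {k} {C' : CNet nA (k + nB) (suc nE)} {ρ₂'} →
               ∃[ ρ₁' ] (Step N m₁ C ρ₁ C' ρ₁' × Related (flip R) m₂ m₁ ρ₂' C' ρ₁') →
               ∃[ ρ₁' ] (Step N m₁ C ρ₁ C' ρ₁' × Related R m₁ m₂ ρ₁' C' ρ₂')
      unflip (ρ₁' , step , rel') = ρ₁' , step , Related-flip rel'

  initial-folding : ∀ {n} → (Fin n → Place) → Folding N n 0
  initial-folding f = record { ρB = f ; ρE = λ () }

  initial-process : ∀ {n} (f : Fin n → Place) → IsProcess N (img f full) (eventless n) (initial-folding f)
  initial-process f = record
    { causal  = eventless-causal
    ; lab-ok  = λ ()
    ; init-ok = lookup-img f full
    ; pre-ok  = λ ()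
    ; post-ok = λ ()
    ; inh-ok  = λ _ ()
    ; Y-ok    = λ _ ()
    }

theorem27 : (N : PTINet) (m₁ m₂ : Marking N) → _∼p_ N m₁ m₂ → _∼cn_ N m₁ m₂
theorem27 N m₁ m₂ (R , bisim , m₁Rm₂) with Lift-enumerate m₁Rm₂
... | n , f₁ , f₂ , related , refl , refl =
  RelatedTriple R m₁ m₂ , Related-isCNBisim bisim ,
  triple (initial-folding f₁) (eventless n) (initial-folding f₂) ,
  record { process₁ = initial-process f₁ ; process₂ = initial-process f₂ ; conditions = related ; events = λ () } ,
  refl , refl , refl , refl , refl
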